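{- Let $G$ be a minimal counterexample as described in the context, with a fixed plane embedding. Let $v$ be a vertex of degree $8$. If $v$ has a neighbour $u$ of degree $2$ such that $u$ and $v$ lie on a common $3$-face, then $v$ has no neighbour $w$ of degree $3$ such that $w$ and $v$ lie on a common $3$-face.
   Context: A total $9$-coloring of a graph assigns to every vertex and every edge one of $9$ colors so that adjacent vertices, edges sharing an endpoint, and a vertex and an edge incident to it all receive different colors. A $4$-fan is a path $x_1x_2x_3x_4x_5$ together with one further vertex adjacent to all of $x_1,\dots,x_5$. A minimal counterexample is a simple planar graph $G$ of maximum degree $8$ containing no subgraph isomorphic to a $4$-fan, having no total $9$-coloring, with $|V(G)|+|E(G)|$ minimum among all such graphs; as part of this standing assumption, for every $x\in V(G)\cup E(G)$ the graph $G-x$ admits a total $9$-coloring. Faces refer to the fixed plane embedding; a $3$-face is a face whose boundary has length $3$. -}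

module Defs where

open import Data.Nat using (ℕ; zero; suc; _+_; _*_; _≤_; _<ᵇ_)
open import Data.Fin using (Fin; toℕ; punchIn; _≟_)

open import Data.Bool using (Bool; true; false; _∧_; _∨_; not; if_then_else_)
open import Data.Bool.Properties using (∧-comm)
open import Data.List using (List; allFin; map)
open import Data.Nat.ListAction using (sum)
open import Data.Product using (Σ; ∃; _×_; _,_; proj₁; proj₂)
open import Data.Empty using (⊥)
open import Relation.Nullary using (¬_)
open import Relation.Nullary.Decidable using (⌊_⌋)
open import Relation.Binary.PropositionalEquality using (_≡_; _≢_; refl; cong; cong₂; trans; sym)
open import Relation.Binary.Construct.Closure.ReflexiveTransitive using (Star)
open import Function.Definitions using (Injective)

record Graph (n : ℕ) : Set where
  field
    adj    : Fin n → Fin n → Bool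
    adj-sym    : ∀ x y → adj x y ≡ adj y x
    adj-irrefl : ∀ x → adj x x ≡ false
open Graph public

Adj : ∀ {n} → Graph n → Fin n → Fin n → Set
Adj G x y = adj G x y ≡ true

deg : ∀ {n} → Graph n → Fin n → ℕ
deg {n} G x = sum (map (λ y → if adj G x y then 1 else 0) (allFin n))

edgeCount : ∀ {n} → Graph n → ℕ
edgeCount {n} G =
  sum (map (λ i → sum (map (λ j → if adj G i j ∧ (toℕ i <ᵇ toℕ j) then 1 else 0)
                            (allFin n)))
           (allFin n))

isolatedCount : ∀ {n} → Graph n → ℕ
isolatedCount {n} G = sum (map (λ x → if isZero (deg G x) then 1 else 0) (allFin n))
  where
  isZero : ℕ → Bool
  isZero zero    = true
  isZero (suc _) = false

MaxDegree : ∀ {n} → Graph n → ℕ → Set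
MaxDegree {n} G Δ = (∀ x → deg G x ≤ Δ) × (∃ λ x → deg G x ≡ Δ)

deleteVertex : ∀ {m} → Graph (suc m) → Fin (suc m) → Graph m
deleteVertex G v = record
  { adj = λ x y → adj G (punchIn v x) (punchIn v y)
  ; adj-sym = λ x y → adj-sym G (punchIn v x) (punchIn v y)
  ; adj-irrefl = λ x → adj-irrefl G (punchIn v x)
  }

samePair : ∀ {n} → Fin n → Fin n → Fin n → Fin n → Bool
samePair x y a b = (⌊ a ≟ x ⌋ ∧ ⌊ b ≟ y ⌋) ∨ (⌊ a ≟ y ⌋ ∧ ⌊ b ≟ x ⌋)

private
  ∨-comm' : ∀ p q → p ∨ q ≡ q ∨ p
  ∨-comm' false false = refl
  ∨-comm' false true  = refl
  ∨-comm' true  false = refl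
  ∨-comm' true  true  = refl

  samePair-sym : ∀ {n} (x y a b : Fin n) → samePair x y a b ≡ samePair x y b a
  samePair-sym x y a b =
    trans (∨-comm' (⌊ a ≟ x ⌋ ∧ ⌊ b ≟ y ⌋) (⌊ a ≟ y ⌋ ∧ ⌊ b ≟ x ⌋))
          (cong₂ _∨_ (∧-comm ⌊ a ≟ y ⌋ ⌊ b ≟ x ⌋) (∧-comm ⌊ a ≟ x ⌋ ⌊ b ≟ y ⌋))

deleteEdge : ∀ {n} → Graph n → Fin n → Fin n → Graph n
deleteEdge G x y = record
  { adj = λ a b → adj G a b ∧ not (samePair x y a b)
  ; adj-sym = λ a b → cong₂ _∧_ (adj-sym G a b) (cong not (samePair-sym x y a b))
  ; adj-irrefl = λ a → cong (_∧ _) (adj-irrefl G a)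
  }

record TotalColoring (k : ℕ) {n : ℕ} (G : Graph n) : Set where
  field
    vcol : Fin n → Fin k
    ecol : Fin n → Fin n → Fin k
    ecol-sym   : ∀ x y → Adj G x y → ecol x y ≡ ecol y x
    vv-proper  : ∀ x y → Adj G x y → vcol x ≢ vcol y
    ee-proper  : ∀ x y z → Adj G x y → Adj G x z → y ≢ z → ecol x y ≢ ecol x z
    ve-proper  : ∀ x y → Adj G x y → vcol x ≢ ecol x y

TotalColorable : ℕ → ∀ {n} → Graph n → Set
TotalColorable k G = TotalColoring k G

-- 4-fan: hub 0 adjacent to 1..5, path 1-2-3-4-5

fanEdge : Fin 6 → Fin 6 → Bool
fanEdge Fin.zero (Fin.suc _) = true
fanEdge (Fin.suc _) Fin.zero = true
fanEdge i j = pathEdge (toℕ i) (toℕ j)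
  where
  pathEdge : ℕ → ℕ → Bool
  pathEdge 1 2 = true
  pathEdge 2 1 = true
  pathEdge 2 3 = true
  pathEdge 3 2 = true
  pathEdge 3 4 = true
  pathEdge 4 3 = true
  pathEdge 4 5 = true
  pathEdge 5 4 = true
  pathEdge _ _ = false

Contains4Fan : ∀ {n} → Graph n → Set
Contains4Fan {n} G =
  Σ (Fin 6 → Fin n) λ f → Injective _≡_ _≡_ f × (∀ i j → fanEdge i j ≡ true → Adj G (f i) (f j))

iter : ∀ {A : Set} → (A → A) → ℕ → A → A
iter f zero    a = a
iter f (suc k) a = f (iter f k a)

-- rot x y = the neighbour of x following y in the cyclic order around x
record RotationSystem {n : ℕ} (G : Graph n) : Set where
  field
    rot     : Fin n → Fin n → Fin n
    rot-adj : ∀ x y → Adj G x y → Adj G x (rot x y)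
    -- rot x is a single cycle on the neighbourhood of x
    rot-cyc : ∀ x y z → Adj G x y → Adj G x z → ∃ λ k → iter (rot x) k y ≡ z
open RotationSystem public

Dart : ℕ → Set
Dart n = Fin n × Fin n

IsDart : ∀ {n} → Graph n → Dart n → Set
IsDart G (a , b) = Adj G a b

faceStep : ∀ {n} {G : Graph n} → RotationSystem G → Dart n → Dart n
faceStep R (a , b) = (b , rot R b a)

SameFace : ∀ {n} {G : Graph n} → RotationSystem G → Dart n → Dart n → Set
SameFace R d d' = ∃ λ k → iter (faceStep R) k d ≡ d'

-- number of faces of the embedding (orbits of faceStep on darts) is F
HasFaceCount : ∀ {n} (G : Graph n) → RotationSystem G → ℕ → Set
HasFaceCount {n} G R F =
  Σ (Fin F → Dart n) λ reps →
    (∀ i → IsDart G (reps i)) ×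
    (∀ d → IsDart G d → ∃ λ i → SameFace R (reps i) d) ×
    (∀ i j → i ≢ j → ¬ SameFace R (reps i) (reps j))

Connected : ∀ {n} → Graph n → Fin n → Fin n → Set
Connected G = Star (Adj G)

HasComponentCount : ∀ {n} → Graph n → ℕ → Set
HasComponentCount {n} G C =
  Σ (Fin C → Fin n) λ reps →
    (∀ x → ∃ λ i → Connected G (reps i) x) ×
    (∀ i j → i ≢ j → ¬ Connected G (reps i) (reps j))

-- the rotation system is a plane embedding: Euler's formula
-- V - E + F + (#isolated vertices) = 2 (#components), i.e. every component has genus 0
PlaneEmbedding : ∀ {n} (G : Graph n) → RotationSystem G → Set
PlaneEmbedding {n} G R =
  Σ ℕ λ F → Σ ℕ λ C → HasFaceCount G R F × HasComponentCount G C ×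
    (n + F + isolatedCount G ≡ 2 * C + edgeCount G)

Planar : ∀ {n} → Graph n → Set
Planar G = Σ (RotationSystem G) λ R → PlaneEmbedding G R

-- u and w lie on a common 3-face (facial walk of length 3: darts (a,b),(b,c),(c,a))
OnCommon3Face : ∀ {n} {G : Graph n} → RotationSystem G → Fin n → Fin n → Set
OnCommon3Face {n} {G} R u w =
  Σ (Fin n) λ a → Σ (Fin n) λ b → Σ (Fin n) λ c →
    Adj G a b ×
    faceStep R (a , b) ≡ (b , c) ×
    faceStep R (b , c) ≡ (c , a) ×
    faceStep R (c , a) ≡ (a , b) ×
    (u ≡ a ⊎' u ≡ b ⊎' u ≡ c) × (w ≡ a ⊎' w ≡ b ⊎' w ≡ c)
  where
  open import Data.Sum using () renaming (_⊎_ to _⊎'_)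

record MinimalCounterexample {m : ℕ} (G : Graph (suc m)) : Set₁ where
  field
    planar     : Planar G
    maxDeg8    : MaxDegree G 8
    no4Fan     : ¬ Contains4Fan G
    notColorable : ¬ TotalColorable 9 G
    minimal    : ∀ n (H : Graph n) → Planar H → MaxDegree H 8 → ¬ Contains4Fan H →
                 ¬ TotalColorable 9 H → suc m + edgeCount G ≤ n + edgeCount H
    delVertex  : ∀ x → TotalColorable 9 (deleteVertex G x)
    delEdge    : ∀ x y → Adj G x y → TotalColorable 9 (deleteEdge G x y)

{-# OPTIONS --safe #-}
module Submission where

-- Let u be the 2-vertex, with neighbours v and x (uvx is a triangle), and w the 3-vertex, with
-- neighbours v, y (vwy is a triangle) and z. Take a total coloring φ of G − uv and uncolor u, ux
-- and w. At most deg v ≤ 8 of the 9 colors then appear at v, and at most deg x ≤ 8 at x, so some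
-- color α is missing at v and some β at x; if β can be chosen different from α, color uv with α
-- and ux with β. Otherwise α is missing at both v and x. Write γ κ μ ρ σ for the colors of
-- vw vx vy wy wz. If α ∉ {ρ, σ}, recolor vw with α; uv gets the freed γ and ux gets α.
-- If κ ∉ {ρ, σ}, recolor vx with α and vw with κ; uv gets γ and ux gets κ. Otherwise
-- {ρ, σ} = {α, κ}: if ρ = α, exchange the colors of vy and wy, which frees μ at v for uv, and
-- ux gets α; if ρ = κ, first recolor vx with α, then exchange, and ux gets κ. Finally w, with
-- 3 neighbours, and u, with 2, are colored greedily.

open import Defs
open import Data.Nat using (ℕ; suc; pred; _+_; _≤_; _<_; _<?_; s≤s; z≤n)
open import Data.Nat.Properties using (<⇒≱; ≤-trans; ≤-reflexive; m≤m+n)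
open import Data.Nat.ListAction using (sum)
open import Data.Fin using (Fin; _≟_)
open import Data.Fin.Properties using (¬∀⟶∃¬; injective⇒≤)
open import Data.Bool using (Bool; true; false; if_then_else_)
import Data.Bool as Bool
open import Data.Maybe using (Maybe; just; nothing; fromMaybe)
open import Data.Maybe.Properties using (just-injective)
open import Data.List using (List; []; _∷_; _++_; length; map; filter; allFin; catMaybes)
open import Data.List.Properties using (length-removeAt′; length-catMaybes; length-++; length-map)
open import Data.List.Relation.Unary.Any using (here; there; any?; _─_)
open import Data.List.Membership.Propositional using (_∈_; _∉_)
open import Data.List.Membership.Propositional.Properties
  using (∈-filter⁺; ∈-filter⁻; ∈-allFin; ∈-map⁺; ∈-++⁺ˡ; ∈-++⁺ʳ)
import Data.List.Membership.Setoid.Properties as SetoidMembership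
open import Data.Product using (Σ; ∃-syntax; _×_; _,_; proj₁; proj₂)
open import Data.Sum using (_⊎_; inj₁; inj₂)
import Data.Sum as Sum
open import Data.Empty using (⊥-elim)
open import Relation.Nullary using (¬_; Dec; yes; no; does)
open import Relation.Nullary.Decidable using (_×-dec_; _⊎-dec_; dec-true; dec-false)
open import Function using (_∘_; id; case_of_)
open import Relation.Binary.PropositionalEquality
  using (_≡_; _≢_; refl; sym; trans; cong; cong₂; subst; setoid; ≢-sym; module ≡-Reasoning)

module _ {A : Set} where

  ∈-─ : ∀ {a t : A} {xs} (a∈ : a ∈ xs) → t ∈ xs → t ≡ a ⊎ t ∈ (xs ─ a∈)
  ∈-─ (here refl) (here refl) = inj₁ refl
  ∈-─ (here refl) (there t∈) = inj₂ t∈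
  ∈-─ (there a∈) (here refl) = inj₂ (here refl)
  ∈-─ (there a∈) (there t∈) = Sum.map₂ there (∈-─ a∈ t∈)

  ─-⊆ : ∀ {a t : A} {xs} (a∈ : a ∈ xs) → t ∈ (xs ─ a∈) → t ∈ xs
  ─-⊆ (here _) t∈ = there t∈
  ─-⊆ (there a∈) (here refl) = here refl
  ─-⊆ (there a∈) (there t∈) = there (─-⊆ a∈ t∈)

  length-─ : ∀ {a : A} {xs m} (a∈ : a ∈ xs) → length xs ≡ suc m → length (xs ─ a∈) ≡ m
  length-─ {xs = xs} a∈ len = cong pred (trans (sym (length-removeAt′ xs _)) len)

  ∈-length-1 : ∀ {xs : List A} → length xs ≡ 1 → ∃[ c ] c ∈ xs × (∀ {t} → t ∈ xs → t ≡ c)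
  ∈-length-1 {c ∷ []} _ = c , here refl , λ { (here refl) → refl }

  ∈-length-2 : ∀ {a b : A} {xs} → length xs ≡ 2 → a ∈ xs → b ∈ xs → b ≢ a →
               ∀ {t} → t ∈ xs → t ≡ a ⊎ t ≡ b
  ∈-length-2 len a∈ b∈ b≢a t∈ with ∈-length-1 (length-─ a∈ len)
  ... | c , _ , only-c with ∈-─ a∈ t∈ | ∈-─ a∈ b∈
  ...   | inj₁ t≡a | _ = inj₁ t≡a
  ...   | inj₂ _ | inj₁ b≡a = ⊥-elim (b≢a b≡a)
  ...   | inj₂ t∈′ | inj₂ b∈′ = inj₂ (trans (only-c t∈′) (sym (only-c b∈′)))

  ∈-length-3 : ∀ {a b : A} {xs} → length xs ≡ 3 → a ∈ xs → b ∈ xs → b ≢ a →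
               ∃[ c ] c ∈ xs × (∀ {t} → t ∈ xs → t ≡ a ⊎ t ≡ b ⊎ t ≡ c)
  ∈-length-3 {a} {b} {xs} len a∈ b∈ b≢a with ∈-─ a∈ b∈
  ... | inj₁ b≡a = ⊥-elim (b≢a b≡a)
  ... | inj₂ b∈′ with ∈-length-1 (length-─ b∈′ (length-─ a∈ len))
  ...   | c , c∈ , only-c = c , ─-⊆ a∈ (─-⊆ b∈′ c∈) , classify
    where
    classify : ∀ {t} → t ∈ xs → t ≡ a ⊎ t ≡ b ⊎ t ≡ c
    classify t∈ with ∈-─ a∈ t∈
    ... | inj₁ t≡a = inj₁ t≡a
    ... | inj₂ t∈′ = inj₂ (Sum.map₂ only-c (∈-─ b∈′ t∈′))

sum-indicator≡length-filter : ∀ {A : Set} (f : A → Bool) xs →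
  sum (map (λ t → if f t then 1 else 0) xs) ≡ length (filter (λ t → f t Bool.≟ true) xs)
sum-indicator≡length-filter f [] = refl
sum-indicator≡length-filter f (t ∷ xs) with f t
... | true = cong suc (sum-indicator≡length-filter f xs)
... | false = sum-indicator≡length-filter f xs

∃-∉ : ∀ {k} (xs : List (Fin k)) → length xs < k → ∃[ c ] c ∉ xs
∃-∉ {k} xs len = ¬∀⟶∃¬ k (_∈ xs) (λ c → any? (c ≟_) xs) λ all∈ →
  <⇒≱ len (injective⇒≤ (SetoidMembership.index-injective (setoid _) (all∈ _) (all∈ _)))

∈-catMaybes : ∀ {A : Set} {c : A} {ms} → just c ∈ ms → c ∈ catMaybes ms
∈-catMaybes (here refl) = here refl
∈-catMaybes {ms = just _ ∷ _} (there c∈) = there (∈-catMaybes c∈)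
∈-catMaybes {ms = nothing ∷ _} (there c∈) = ∈-catMaybes c∈

∃-fresh : ∀ {k} (ms : List (Maybe (Fin k))) → length ms < k → ∃[ c ] just c ∉ ms
∃-fresh ms len with c , c∉ ← ∃-∉ (catMaybes ms) (≤-trans (s≤s (length-catMaybes ms)) len) =
  c , c∉ ∘ ∈-catMaybes

module _ {A : Set} where

  fromJust : {m : Maybe A} → m ≢ nothing → A
  fromJust {just c} _ = c
  fromJust {nothing} m≢ = ⊥-elim (m≢ refl)

  just-fromJust : {m : Maybe A} (m≢ : m ≢ nothing) → m ≡ just (fromJust m≢)
  just-fromJust {just c} _ = refl
  just-fromJust {nothing} m≢ = ⊥-elim (m≢ refl)

  just-fromMaybe : ∀ {m : Maybe A} d → m ≢ nothing → m ≡ just (fromMaybe d m)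
  just-fromMaybe {just c} _ _ = refl
  just-fromMaybe {nothing} _ m≢ = ⊥-elim (m≢ refl)

  ≡just⇒≢nothing : ∀ {m : Maybe A} {a} → m ≡ just a → m ≢ nothing
  ≡just⇒≢nothing refl ()

  ≡nothing⇒≢just : ∀ {m : Maybe A} {a} → m ≡ nothing → m ≢ just a
  ≡nothing⇒≢just refl ()

  ≡just⇒≢just : ∀ {m : Maybe A} {a b} → m ≡ just a → a ≢ b → m ≢ just b
  ≡just⇒≢just refl a≢b = a≢b ∘ just-injective

SameEdge : ∀ {n} → Fin n → Fin n → Fin n → Fin n → Set
SameEdge p q a b = (a ≡ p × b ≡ q) ⊎ (a ≡ q × b ≡ p)

-- Opaque, so that `with sameEdge? …` abstracts it instead of seeing it unfold.
opaque
  sameEdge? : ∀ {n} (p q a b : Fin n) → Dec (SameEdge p q a b)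
  sameEdge? p q a b = ((a ≟ p) ×-dec (b ≟ q)) ⊎-dec ((a ≟ q) ×-dec (b ≟ p))

module _ {n : ℕ} {p q a b : Fin n} where

  sameEdge-sym : SameEdge p q a b → SameEdge p q b a
  sameEdge-sym (inj₁ (a≡p , b≡q)) = inj₂ (b≡q , a≡p)
  sameEdge-sym (inj₂ (a≡q , b≡p)) = inj₁ (b≡p , a≡q)

  sameEdge-flip : SameEdge p q a b → SameEdge q p a b
  sameEdge-flip (inj₁ (a≡p , b≡q)) = inj₂ (a≡p , b≡q)
  sameEdge-flip (inj₂ (a≡q , b≡p)) = inj₁ (a≡q , b≡p)

  misses : a ≢ p → b ≢ p → ¬ SameEdge p q a b
  misses a≢p _ (inj₁ (a≡p , _)) = a≢p a≡p
  misses _ b≢p (inj₂ (_ , b≡p)) = b≢p b≡p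

  farˡ : a ≢ p → a ≢ q → ¬ SameEdge p q a b
  farˡ a≢p _ (inj₁ (a≡p , _)) = a≢p a≡p
  farˡ _ a≢q (inj₂ (a≡q , _)) = a≢q a≡q

  farʳ : b ≢ p → b ≢ q → ¬ SameEdge p q a b
  farʳ _ b≢q (inj₁ (_ , b≡q)) = b≢q b≡q
  farʳ b≢p _ (inj₂ (_ , b≡p)) = b≢p b≡p

module _ {n : ℕ} (G : Graph n) where

  Adj⇒≢ : ∀ {a b} → Adj G a b → a ≢ b
  Adj⇒≢ {a} a~b refl with () ← trans (sym (adj-irrefl G a)) a~b

  Adj-sym : ∀ {a b} → Adj G a b → Adj G b a
  Adj-sym {a} {b} a~b = trans (adj-sym G b a) a~b

  sameEdge-unique : ∀ {p q a b c} → Adj G a c → SameEdge p q a b → SameEdge p q a c → b ≡ c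
  sameEdge-unique _ (inj₁ (_ , b≡q)) (inj₁ (_ , c≡q)) = trans b≡q (sym c≡q)
  sameEdge-unique a~c (inj₁ (a≡p , _)) (inj₂ (_ , c≡p)) = ⊥-elim (Adj⇒≢ a~c (trans a≡p (sym c≡p)))
  sameEdge-unique a~c (inj₂ (a≡q , _)) (inj₁ (_ , c≡q)) = ⊥-elim (Adj⇒≢ a~c (trans a≡q (sym c≡q)))
  sameEdge-unique _ (inj₂ (_ , b≡p)) (inj₂ (_ , c≡p)) = trans b≡p (sym c≡p)

  adj-deleteEdge : ∀ {p q a b} → Adj G a b → ¬ SameEdge p q a b → Adj (deleteEdge G p q) a b
  adj-deleteEdge {p} {q} {a} {b} a~b ¬s rewrite a~b with a ≟ p | b ≟ q | a ≟ q | b ≟ p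
  ... | yes a≡p | yes b≡q | _ | _ = ⊥-elim (¬s (inj₁ (a≡p , b≡q)))
  ... | _ | _ | yes a≡q | yes b≡p = ⊥-elim (¬s (inj₂ (a≡q , b≡p)))
  ... | no _ | _ | no _ | _ = refl
  ... | no _ | _ | yes _ | no _ = refl
  ... | yes _ | no _ | no _ | _ = refl
  ... | yes _ | no _ | yes _ | no _ = refl

  neighbours : Fin n → List (Fin n)
  neighbours p = filter (λ t → adj G p t Bool.≟ true) (allFin n)

  ∈-neighbours⁺ : ∀ {p t} → Adj G p t → t ∈ neighbours p
  ∈-neighbours⁺ p~t = ∈-filter⁺ (λ t → adj G _ t Bool.≟ true) (∈-allFin _) p~t

  ∈-neighbours⁻ : ∀ {p t} → t ∈ neighbours p → Adj G p t
  ∈-neighbours⁻ t∈ = proj₂ (∈-filter⁻ (λ t → adj G _ t Bool.≟ true) {xs = allFin n} t∈)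

  deg≡length-neighbours : ∀ p → deg G p ≡ length (neighbours p)
  deg≡length-neighbours p = sum-indicator≡length-filter (adj G p) (allFin n)

  neighbours-of-deg-2 : ∀ {p a b} → deg G p ≡ 2 → Adj G p a → Adj G p b → b ≢ a →
                        ∀ {t} → Adj G p t → t ≡ a ⊎ t ≡ b
  neighbours-of-deg-2 {p} deg-p p~a p~b b≢a p~t =
    ∈-length-2 (trans (sym (deg≡length-neighbours p)) deg-p)
               (∈-neighbours⁺ p~a) (∈-neighbours⁺ p~b) b≢a (∈-neighbours⁺ p~t)

  neighbours-of-deg-3 : ∀ {p a b} → deg G p ≡ 3 → Adj G p a → Adj G p b → b ≢ a →
                        ∃[ c ] Adj G p c × (∀ {t} → Adj G p t → t ≡ a ⊎ t ≡ b ⊎ t ≡ c)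
  neighbours-of-deg-3 {p} deg-p p~a p~b b≢a
    with c , c∈ , classify ← ∈-length-3 (trans (sym (deg≡length-neighbours p)) deg-p)
                                        (∈-neighbours⁺ p~a) (∈-neighbours⁺ p~b) b≢a
    = c , ∈-neighbours⁻ c∈ , λ p~t → classify (∈-neighbours⁺ p~t)

  common-neighbour : (R : RotationSystem G) {p q : Fin n} → OnCommon3Face R p q → p ≢ q →
                     ∃[ r ] Adj G p r × Adj G q r
  common-neighbour R {p} {q} (a , b , c , a~b , ab↦bc , bc↦ca , _ , p∈ , q∈) p≢q = pick p∈ q∈
    where
    b~c : Adj G b c
    b~c = subst (Adj G b) (cong proj₂ ab↦bc) (rot-adj R b a (Adj-sym a~b))

    c~a : Adj G c a
    c~a = subst (Adj G c) (cong proj₂ bc↦ca) (rot-adj R c b (Adj-sym b~c))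

    pick : p ≡ a ⊎ p ≡ b ⊎ p ≡ c → q ≡ a ⊎ q ≡ b ⊎ q ≡ c → ∃[ r ] Adj G p r × Adj G q r
    pick (inj₁ refl) (inj₂ (inj₁ refl)) = c , Adj-sym c~a , b~c
    pick (inj₁ refl) (inj₂ (inj₂ refl)) = b , a~b , Adj-sym b~c
    pick (inj₂ (inj₁ refl)) (inj₁ refl) = c , b~c , Adj-sym c~a
    pick (inj₂ (inj₁ refl)) (inj₂ (inj₂ refl)) = a , Adj-sym a~b , c~a
    pick (inj₂ (inj₂ refl)) (inj₁ refl) = b , Adj-sym b~c , a~b
    pick (inj₂ (inj₂ refl)) (inj₂ (inj₁ refl)) = a , c~a , Adj-sym a~b
    pick (inj₁ refl) (inj₁ refl) = ⊥-elim (p≢q refl)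
    pick (inj₂ (inj₁ refl)) (inj₂ (inj₁ refl)) = ⊥-elim (p≢q refl)
    pick (inj₂ (inj₂ refl)) (inj₂ (inj₂ refl)) = ⊥-elim (p≢q refl)

Apart : ∀ {A : Set} → Maybe A → Maybe A → Set
Apart m m′ = ∀ {c} → m ≡ just c → m′ ≢ just c

apart⇒≢ : ∀ {A : Set} {m m′ : Maybe A} {a b} → Apart m m′ → m ≡ just a → m′ ≡ just b → a ≢ b
apart⇒≢ m#m′ m≡a m′≡b refl = m#m′ m≡a m′≡b

module PartialColorings {n k : ℕ} (G : Graph n) where

  open ≡-Reasoning

  record PartialColoring : Set where
    field
      vcol : Fin n → Maybe (Fin k)
      ecol : Fin n → Fin n → Maybe (Fin k)
      ecol-sym : ∀ {a b} → Adj G a b → ecol a b ≡ ecol b a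
      vv-apart : ∀ {a b} → Adj G a b → Apart (vcol a) (vcol b)
      ee-apart : ∀ {a b c} → Adj G a b → Adj G a c → b ≢ c → Apart (ecol a b) (ecol a c)
      ve-apart : ∀ {a b} → Adj G a b → Apart (vcol a) (ecol a b)
  open PartialColoring public

  record Avoids (S : PartialColoring) (p q : Fin n) (c : Fin k) : Set where
    constructor avoiding
    field
      vertex : vcol S p ≢ just c
      edge : ∀ {t} → Adj G p t → t ≢ q → ecol S p t ≢ just c

  record Missing (S : PartialColoring) (p : Fin n) (c : Fin k) : Set where
    constructor missing
    field
      vertex : vcol S p ≢ just c
      edge : ∀ {t} → Adj G p t → ecol S p t ≢ just c

  record Agree (S T : PartialColoring) (r : Fin n) : Set where
    constructor agreeing
    field
      vertex : vcol T r ≡ vcol S r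
      edge : ∀ t → ecol T r t ≡ ecol S r t

  module _ {S : PartialColoring} {p q : Fin n} {c : Fin k} where

    missing⇒avoids : Missing S p c → Avoids S p q c
    missing⇒avoids (missing vp ep) = avoiding vp λ p~t _ → ep p~t

    avoids⇒missing : Avoids S p q c → ecol S p q ≢ just c → Missing S p c
    avoids⇒missing (avoiding vp ep) pq = missing vp λ {t} p~t → case t ≟ q of λ
      { (yes refl) → pq
      ; (no t≢q) → ep p~t t≢q }

    own-avoids : Adj G p q → ecol S p q ≡ just c → Avoids S p q c
    own-avoids p~q pq≡c = avoiding (λ vp≡c → ve-apart S p~q vp≡c pq≡c)
                                   λ p~t t≢q pt≡c → ee-apart S p~q p~t (≢-sym t≢q) pq≡c pt≡c

  module _ {S T : PartialColoring} {r : Fin n} where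

    avoids-agree : Agree S T r → ∀ {q c} → Avoids S r q c → Avoids T r q c
    avoids-agree (agreeing v≡ e≡) (avoiding vr er) =
      avoiding (λ h → vr (trans (sym v≡) h)) λ r~t t≢q h → er r~t t≢q (trans (sym (e≡ _)) h)

    missing-agree : Agree S T r → ∀ {c} → Missing S r c → Missing T r c
    missing-agree (agreeing v≡ e≡) (missing vr er) =
      missing (λ h → vr (trans (sym v≡) h)) λ r~t h → er r~t (trans (sym (e≡ _)) h)

  agree-trans : ∀ {S T U r} → Agree S T r → Agree T U r → Agree S U r
  agree-trans (agreeing v₁ e₁) (agreeing v₂ e₂) = agreeing (trans v₂ v₁) λ t → trans (e₂ t) (e₁ t)

  Fits : PartialColoring → Fin n → Fin n → Maybe (Fin k) → Set
  Fits S p q m = ∀ {c} → m ≡ just c → Avoids S p q c × Avoids S q p c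

  module SetEdge (S : PartialColoring) (p q : Fin n) (m : Maybe (Fin k)) (fits : Fits S p q m) where
    opaque
      updated : Fin n → Fin n → Maybe (Fin k)
      updated a b = if does (sameEdge? p q a b) then m else ecol S a b

      on : ∀ {a b} → SameEdge p q a b → updated a b ≡ m
      on {a} {b} s rewrite dec-true (sameEdge? p q a b) s = refl

      off : ∀ {a b} → ¬ SameEdge p q a b → updated a b ≡ ecol S a b
      off {a} {b} ¬s rewrite dec-false (sameEdge? p q a b) ¬s = refl

    private
      fits-edge : ∀ {a b t} → SameEdge p q a b → Adj G a t → t ≢ b → Apart m (ecol S a t)
      fits-edge (inj₁ (refl , refl)) a~t t≢b m≡c = Avoids.edge (proj₁ (fits m≡c)) a~t t≢b
      fits-edge (inj₂ (refl , refl)) a~t t≢b m≡c = Avoids.edge (proj₂ (fits m≡c)) a~t t≢b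

      fits-vertex : ∀ {a b} → SameEdge p q a b → Apart (vcol S a) m
      fits-vertex (inj₁ (refl , refl)) va≡c m≡c = Avoids.vertex (proj₁ (fits m≡c)) va≡c
      fits-vertex (inj₂ (refl , refl)) va≡c m≡c = Avoids.vertex (proj₂ (fits m≡c)) va≡c

      updated-sym : ∀ {a b} → Adj G a b → updated a b ≡ updated b a
      updated-sym {a} {b} a~b with sameEdge? p q a b
      ... | yes s = trans (on s) (sym (on (sameEdge-sym s)))
      ... | no ¬s = trans (off ¬s) (trans (ecol-sym S a~b) (sym (off (¬s ∘ sameEdge-sym))))

      ee-apart′ : ∀ {a b c} → Adj G a b → Adj G a c → b ≢ c → Apart (updated a b) (updated a c)
      ee-apart′ {a} {b} {c} a~b a~c b≢c with sameEdge? p q a b | sameEdge? p q a c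
      ... | yes s | yes s′ = ⊥-elim (b≢c (sameEdge-unique G a~c s s′))
      ... | yes s | no ¬s′ = λ h₁ h₂ →
        fits-edge s a~c (≢-sym b≢c) (trans (sym (on s)) h₁) (trans (sym (off ¬s′)) h₂)
      ... | no ¬s | yes s′ = λ h₁ h₂ →
        fits-edge s′ a~b b≢c (trans (sym (on s′)) h₂) (trans (sym (off ¬s)) h₁)
      ... | no ¬s | no ¬s′ = λ h₁ h₂ →
        ee-apart S a~b a~c b≢c (trans (sym (off ¬s)) h₁) (trans (sym (off ¬s′)) h₂)

      ve-apart′ : ∀ {a b} → Adj G a b → Apart (vcol S a) (updated a b)
      ve-apart′ {a} {b} a~b with sameEdge? p q a b
      ... | yes s = λ h₁ h₂ → fits-vertex s h₁ (trans (sym (on s)) h₂)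
      ... | no ¬s = λ h₁ h₂ → ve-apart S a~b h₁ (trans (sym (off ¬s)) h₂)

    coloring : PartialColoring
    coloring = record
      { vcol = vcol S
      ; ecol = updated
      ; ecol-sym = updated-sym
      ; vv-apart = vv-apart S
      ; ee-apart = ee-apart′
      ; ve-apart = ve-apart′
      }

    agree : ∀ {r} → r ≢ p → r ≢ q → Agree S coloring r
    agree r≢p r≢q = agreeing refl λ _ → off (farˡ r≢p r≢q)

    avoids-kept : ∀ {r s c} → SameEdge p q r s → Avoids S r s c → Avoids coloring r s c
    avoids-kept s≡ (avoiding vr er) = avoiding vr λ r~t t≢s h →
      er r~t t≢s (trans (sym (off (≢-sym t≢s ∘ sameEdge-unique G r~t s≡))) h)

    frees : ∀ {r s c} → Adj G r s → ecol S r s ≡ just c → m ≢ just c → SameEdge p q r s →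
            Missing coloring r c
    frees r~s rs≡c m≢c s≡ =
      avoids⇒missing {S = coloring} (avoids-kept s≡ (own-avoids {S = S} r~s rs≡c))
        (λ h → m≢c (trans (sym (on s≡)) h))

    colored : m ≢ nothing → ∀ {a b} → ecol S a b ≢ nothing → ecol coloring a b ≢ nothing
    colored m≢ {a} {b} ab≢ with sameEdge? p q a b
    ... | yes s = λ h → m≢ (trans (sym (on s)) h)
    ... | no ¬s = λ h → ab≢ (trans (sym (off ¬s)) h)

  colorFits : ∀ {S p q c} → Avoids S p q c → Avoids S q p c → Fits S p q (just c)
  colorFits avoids-p avoids-q refl = avoids-p , avoids-q

  module ColorEdge (S : PartialColoring) (p q : Fin n) (c : Fin k)
                   (avoids-p : Avoids S p q c) (avoids-q : Avoids S q p c) =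
    SetEdge S p q (just c) (colorFits avoids-p avoids-q)

  module UncolorEdge (S : PartialColoring) (p q : Fin n) = SetEdge S p q nothing (λ ())

  VertexAvoids : PartialColoring → Fin n → Fin k → Set
  VertexAvoids S p c = ∀ {t} → Adj G p t → vcol S t ≢ just c × ecol S p t ≢ just c

  VertexFits : PartialColoring → Fin n → Maybe (Fin k) → Set
  VertexFits S p m = ∀ {c} → m ≡ just c → VertexAvoids S p c

  module SetVertex (S : PartialColoring) (p : Fin n) (m : Maybe (Fin k)) (fits : VertexFits S p m) where
    opaque
      updated : Fin n → Maybe (Fin k)
      updated a = if does (a ≟ p) then m else vcol S a

      on : updated p ≡ m
      on rewrite dec-true (p ≟ p) refl = refl

      off : ∀ {a} → a ≢ p → updated a ≡ vcol S a
      off {a} a≢p rewrite dec-false (a ≟ p) a≢p = refl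

    private
      vv-apart′ : ∀ {a b} → Adj G a b → Apart (updated a) (updated b)
      vv-apart′ {a} {b} a~b with a ≟ p | b ≟ p
      ... | yes refl | yes refl = ⊥-elim (Adj⇒≢ G a~b refl)
      ... | yes refl | no b≢p = λ h₁ h₂ →
        proj₁ (fits (trans (sym on) h₁) a~b) (trans (sym (off b≢p)) h₂)
      ... | no a≢p | yes refl = λ h₁ h₂ →
        proj₁ (fits (trans (sym on) h₂) (Adj-sym G a~b)) (trans (sym (off a≢p)) h₁)
      ... | no a≢p | no b≢p = λ h₁ h₂ →
        vv-apart S a~b (trans (sym (off a≢p)) h₁) (trans (sym (off b≢p)) h₂)

      ve-apart′ : ∀ {a b} → Adj G a b → Apart (updated a) (ecol S a b)
      ve-apart′ {a} a~b with a ≟ p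
      ... | yes refl = λ h₁ h₂ → proj₂ (fits (trans (sym on) h₁) a~b) h₂
      ... | no a≢p = λ h₁ h₂ → ve-apart S a~b (trans (sym (off a≢p)) h₁) h₂

    coloring : PartialColoring
    coloring = record
      { vcol = updated
      ; ecol = ecol S
      ; ecol-sym = ecol-sym S
      ; vv-apart = vv-apart′
      ; ee-apart = ee-apart S
      ; ve-apart = ve-apart′
      }

    colored : m ≢ nothing → ∀ {a} → (a ≢ p → vcol S a ≢ nothing) → vcol coloring a ≢ nothing
    colored m≢ {a} colored-a with a ≟ p
    ... | yes refl = λ h → m≢ (trans (sym on) h)
    ... | no a≢p = λ h → colored-a a≢p (trans (sym (off a≢p)) h)

  vertexFits : ∀ {S p c} → VertexAvoids S p c → VertexFits S p (just c)
  vertexFits avoids refl = avoids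

  module ColorVertex (S : PartialColoring) (p : Fin n) (c : Fin k) (avoids : VertexAvoids S p c) =
    SetVertex S p (just c) (vertexFits {S} avoids)

  module UncolorVertex (S : PartialColoring) (p : Fin n) = SetVertex S p nothing (λ ())

  -- The Kempe change on the path a–y–b: ya gets d and yb gets c.
  module Swap (S : PartialColoring) {y a b : Fin n} {c d : Fin k}
              (y~a : Adj G y a) (y~b : Adj G y b) (a≢b : a ≢ b)
              (ya≡c : ecol S y a ≡ just c) (yb≡d : ecol S y b ≡ just d)
              (avoids-a : Avoids S a y d) (avoids-b : Avoids S b y c) where

    private
      a≢y : a ≢ y
      a≢y = Adj⇒≢ G (Adj-sym G y~a)

      b≢y : b ≢ y
      b≢y = Adj⇒≢ G (Adj-sym G y~b)

      c≢d : c ≢ d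
      c≢d refl = ee-apart S y~a y~b a≢b ya≡c yb≡d

      module S₁ = UncolorEdge S y b

      d-free-y : Missing S₁.coloring y d
      d-free-y = S₁.frees y~b yb≡d (λ ()) (inj₁ (refl , refl))

      module S₂ = ColorEdge S₁.coloring a y d (avoids-agree (S₁.agree a≢y a≢b) avoids-a)
                                               (missing⇒avoids d-free-y)

      c-free-y : Missing S₂.coloring y c
      c-free-y = S₂.frees y~a (trans (S₁.off (farʳ a≢y a≢b)) ya≡c) (c≢d ∘ sym ∘ just-injective)
                   (inj₂ (refl , refl))

      avoids-b₂ : Avoids S₂.coloring b y c
      avoids-b₂ = avoids-agree (S₂.agree (≢-sym a≢b) b≢y)
                    (S₁.avoids-kept (inj₂ (refl , refl)) avoids-b)

      module S₃ = ColorEdge S₂.coloring b y c avoids-b₂ (missing⇒avoids c-free-y)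

    coloring : PartialColoring
    coloring = S₃.coloring

    frees : Missing coloring a c
    frees = missing-agree (S₃.agree a≢b a≢y)
              (S₂.frees (Adj-sym G y~a) ay≡c (c≢d ∘ sym ∘ just-injective) (inj₁ (refl , refl)))
      where
      ay≡c : ecol S₁.coloring a y ≡ just c
      ay≡c = trans (S₁.off (farˡ a≢y a≢b)) (trans (ecol-sym S (Adj-sym G y~a)) ya≡c)

    agree : ∀ {r} → r ≢ y → r ≢ a → r ≢ b → Agree S coloring r
    agree r≢y r≢a r≢b =
      agree-trans (S₁.agree r≢y r≢b) (agree-trans (S₂.agree r≢a r≢y) (S₃.agree r≢b r≢y))

    colored : ∀ {e f} → ecol S e f ≢ nothing → ecol coloring e f ≢ nothing
    colored {e} {f} ef≢ = case sameEdge? b y e f of λ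
      { (yes s) → ≡just⇒≢nothing (S₃.on s)
      ; (no ¬s) h → S₂.colored (λ ()) (λ h′ → ef≢ (trans (sym (S₁.off (¬s ∘ sameEdge-flip))) h′))
                                (trans (sym (S₃.off ¬s)) h) }

  -- The vertex p is left uncolored: p and q are not adjacent in G − pq, so φ may color them alike.
  module FromDeleteEdge {p q : Fin n} (φ : TotalColoring k (deleteEdge G p q)) where

    private
      φv : Fin n → Fin k
      φv = TotalColoring.vcol φ

      φe : Fin n → Fin n → Fin k
      φe = TotalColoring.ecol φ

    opaque
      vertexColor : Fin n → Maybe (Fin k)
      vertexColor a = if does (a ≟ p) then nothing else just (φv a)

      edgeColor : Fin n → Fin n → Maybe (Fin k)
      edgeColor a b = if does (sameEdge? p q a b) then nothing else just (φe a b)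

      vertexColor-just : ∀ {a c} → vertexColor a ≡ just c → a ≢ p × φv a ≡ c
      vertexColor-just {a} h with a ≟ p
      ... | no a≢p = a≢p , just-injective h

      vertexColor-off : ∀ {a} → a ≢ p → vertexColor a ≡ just (φv a)
      vertexColor-off {a} a≢p rewrite dec-false (a ≟ p) a≢p = refl

      edgeColor-just : ∀ {a b c} → edgeColor a b ≡ just c → ¬ SameEdge p q a b × φe a b ≡ c
      edgeColor-just {a} {b} h with sameEdge? p q a b
      ... | no ¬s = ¬s , just-injective h

      edgeColor-on : ∀ {a b} → SameEdge p q a b → edgeColor a b ≡ nothing
      edgeColor-on {a} {b} s rewrite dec-true (sameEdge? p q a b) s = refl

      edgeColor-off : ∀ {a b} → ¬ SameEdge p q a b → edgeColor a b ≡ just (φe a b)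
      edgeColor-off {a} {b} ¬s rewrite dec-false (sameEdge? p q a b) ¬s = refl

    private
      edgeColor-sym : ∀ {a b} → Adj G a b → edgeColor a b ≡ edgeColor b a
      edgeColor-sym {a} {b} a~b = case sameEdge? p q a b of λ
        { (yes s) → trans (edgeColor-on s) (sym (edgeColor-on (sameEdge-sym s)))
        ; (no ¬s) → trans (edgeColor-off ¬s)
                      (trans (cong just (TotalColoring.ecol-sym φ a b (adj-deleteEdge G a~b ¬s)))
                             (sym (edgeColor-off (¬s ∘ sameEdge-sym)))) }

      vv-apart′ : ∀ {a b} → Adj G a b → Apart (vertexColor a) (vertexColor b)
      vv-apart′ a~b h₁ h₂ with vertexColor-just h₁ | vertexColor-just h₂
      ... | a≢p , refl | b≢p , φvb≡ =
        TotalColoring.vv-proper φ _ _ (adj-deleteEdge G a~b (misses a≢p b≢p)) (sym φvb≡)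

      ee-apart′ : ∀ {a b c} → Adj G a b → Adj G a c → b ≢ c → Apart (edgeColor a b) (edgeColor a c)
      ee-apart′ a~b a~c b≢c h₁ h₂ with edgeColor-just h₁ | edgeColor-just h₂
      ... | ¬s , refl | ¬s′ , φe≡ =
        TotalColoring.ee-proper φ _ _ _ (adj-deleteEdge G a~b ¬s) (adj-deleteEdge G a~c ¬s′) b≢c (sym φe≡)

      ve-apart′ : ∀ {a b} → Adj G a b → Apart (vertexColor a) (edgeColor a b)
      ve-apart′ a~b h₁ h₂ with vertexColor-just h₁ | edgeColor-just h₂
      ... | _ , refl | ¬s , φe≡ = TotalColoring.ve-proper φ _ _ (adj-deleteEdge G a~b ¬s) (sym φe≡)

    coloring : PartialColoring
    coloring = record
      { vcol = vertexColor
      ; ecol = edgeColor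
      ; ecol-sym = edgeColor-sym
      ; vv-apart = vv-apart′
      ; ee-apart = ee-apart′
      ; ve-apart = ve-apart′
      }

  toTotal : (S : PartialColoring) → (∀ a → vcol S a ≢ nothing) →
            (∀ {a b} → Adj G a b → ecol S a b ≢ nothing) → TotalColoring k G
  toTotal S vs es = record
    { vcol = vc
    ; ecol = ec
    ; ecol-sym = λ a b a~b →
        just-injective (trans (sym (ec≡ a~b)) (trans (ecol-sym S a~b) (ec≡ (Adj-sym G a~b))))
    ; vv-proper = λ a b a~b eq → vv-apart S a~b (vc≡ a) (trans (vc≡ b) (cong just (sym eq)))
    ; ee-proper = λ a b c a~b a~c b≢c eq →
        ee-apart S a~b a~c b≢c (ec≡ a~b) (trans (ec≡ a~c) (cong just (sym eq)))
    ; ve-proper = λ a b a~b eq → ve-apart S a~b (vc≡ a) (trans (ec≡ a~b) (cong just (sym eq)))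
    }
    where
    vc : Fin n → Fin k
    vc a = fromJust (vs a)

    ec : Fin n → Fin n → Fin k
    ec a b = fromMaybe (vc a) (ecol S a b)

    vc≡ : ∀ a → vcol S a ≡ just (vc a)
    vc≡ a = just-fromJust (vs a)

    ec≡ : ∀ {a b} → Adj G a b → ecol S a b ≡ just (ec a b)
    ec≡ a~b = just-fromMaybe _ (es a~b)

  ∃-avoids : (S : PartialColoring) {p q : Fin n} (ex : List (Fin k)) → Adj G p q →
             length ex + deg G p < k → ∃[ c ] c ∉ ex × Avoids S p q c
  ∃-avoids S {p} {q} ex p~q len = from-fresh (∃-fresh colors (subst (_< k) (sym length≡) len))
    where
    q∈ : q ∈ neighbours G p
    q∈ = ∈-neighbours⁺ G p~q

    others : List (Fin n)
    others = neighbours G p ─ q∈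

    ∈-others : ∀ {t} → Adj G p t → t ≢ q → t ∈ others
    ∈-others p~t t≢q = Sum.[ ⊥-elim ∘ t≢q , id ] (∈-─ q∈ (∈-neighbours⁺ G p~t))

    colors : List (Maybe (Fin k))
    colors = map just ex ++ vcol S p ∷ map (ecol S p) others

    length≡ : length colors ≡ length ex + deg G p
    length≡ = begin
      length colors
        ≡⟨ length-++ (map just ex) ⟩
      length (map just ex) + suc (length (map (ecol S p) others))
        ≡⟨ cong₂ (λ i j → i + suc j) (length-map just ex) (length-map _ others) ⟩
      length ex + suc (length others)
        ≡⟨ cong (length ex +_) (sym (length-removeAt′ (neighbours G p) _)) ⟩
      length ex + length (neighbours G p)
        ≡⟨ cong (length ex +_) (sym (deg≡length-neighbours G p)) ⟩
      length ex + deg G p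
        ∎

    from-fresh : ∃[ c ] just c ∉ colors → ∃[ c ] c ∉ ex × Avoids S p q c
    from-fresh (c , c∉) =
      c , (λ c∈ → c∉ (∈-++⁺ˡ (∈-map⁺ just c∈)))
        , avoiding (λ h → c∉ (∈-++⁺ʳ (map just ex) (here (sym h))))
                   (λ p~t t≢q h → c∉ (∈-++⁺ʳ (map just ex)
                     (there (subst (_∈ map (ecol S p) others) h (∈-map⁺ (ecol S p) (∈-others p~t t≢q))))))

  ∃-vertexAvoids : (S : PartialColoring) {p : Fin n} (ts : List (Fin n)) → (∀ {t} → Adj G p t → t ∈ ts) →
                   length ts + length ts < k → ∃[ c ] VertexAvoids S p c
  ∃-vertexAvoids S {p} ts cover len = from-fresh (∃-fresh colors (subst (_< k) (sym length≡) len))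
    where
    colors : List (Maybe (Fin k))
    colors = map (vcol S) ts ++ map (ecol S p) ts

    length≡ : length colors ≡ length ts + length ts
    length≡ = trans (length-++ (map (vcol S) ts)) (cong₂ _+_ (length-map _ ts) (length-map _ ts))

    from-fresh : ∃[ c ] just c ∉ colors → ∃[ c ] VertexAvoids S p c
    from-fresh (c , c∉) =
      c , λ p~t → (λ h → c∉ (∈-++⁺ˡ (subst (_∈ map (vcol S) ts) h (∈-map⁺ (vcol S) (cover p~t)))))
                , (λ h → c∉ (∈-++⁺ʳ (map (vcol S) ts)
                              (subst (_∈ map (ecol S p) ts) h (∈-map⁺ (ecol S p) (cover p~t)))))

module Reducible {n k : ℕ} {G : Graph n} (7≤k : 7 ≤ k) {u v x w y : Fin n}
                 (u~v : Adj G u v) (u~x : Adj G u x) (v~x : Adj G v x) (deg-u : deg G u ≡ 2)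
                 (w~v : Adj G w v) (w~y : Adj G w y) (v~y : Adj G v y) (deg-w : deg G w ≡ 3)
                 (deg-v : deg G v < k) (deg-x : deg G x < k)
                 (φ : TotalColoring k (deleteEdge G u v)) where

  open PartialColorings {k = k} G

  private
    φe : Fin n → Fin n → Fin k
    φe = TotalColoring.ecol φ

    u≢v : u ≢ v
    u≢v = Adj⇒≢ G u~v

    u≢x : u ≢ x
    u≢x = Adj⇒≢ G u~x

    v≢x : v ≢ x
    v≢x = Adj⇒≢ G v~x

    w≢v : w ≢ v
    w≢v = Adj⇒≢ G w~v

    w≢y : w ≢ y
    w≢y = Adj⇒≢ G w~y

    v≢y : v ≢ y
    v≢y = Adj⇒≢ G v~y

    u≢w : u ≢ w
    u≢w u≡w with () ← trans (sym deg-u) (trans (cong (deg G) u≡w) deg-w)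

    5≤k : 5 ≤ k
    5≤k = ≤-trans (s≤s (s≤s (s≤s (s≤s (s≤s z≤n))))) 7≤k

  neighbour-of-u : ∀ {t} → Adj G u t → t ≡ v ⊎ t ≡ x
  neighbour-of-u = neighbours-of-deg-2 G deg-u u~v u~x (≢-sym v≢x)

  third-neighbour-of-w : ∃[ z ] Adj G w z × (∀ {t} → Adj G w t → t ≡ v ⊎ t ≡ y ⊎ t ≡ z)
  third-neighbour-of-w = neighbours-of-deg-3 G deg-w w~v w~y (≢-sym v≢y)

  z : Fin n
  z = proj₁ third-neighbour-of-w

  w~z : Adj G w z
  w~z = proj₁ (proj₂ third-neighbour-of-w)

  neighbour-of-w : ∀ {t} → Adj G w t → t ≡ v ⊎ t ≡ y ⊎ t ≡ z
  neighbour-of-w = proj₂ (proj₂ third-neighbour-of-w)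

  module Restrict = FromDeleteEdge φ
  module Drop-ux = UncolorEdge Restrict.coloring u x
  module Drop-w = UncolorVertex Drop-ux.coloring w

  S₀ : PartialColoring
  S₀ = Drop-w.coloring

  S₀-ecol : ∀ {a b} → a ≢ u → b ≢ u → ecol S₀ a b ≡ just (φe a b)
  S₀-ecol a≢u b≢u = trans (Drop-ux.off (misses a≢u b≢u)) (Restrict.edgeColor-off (misses a≢u b≢u))

  S₀-ecol′ : ∀ {a b} → Adj G a b → a ≢ u → b ≢ u → ecol S₀ b a ≡ just (φe a b)
  S₀-ecol′ a~b a≢u b≢u = trans (sym (ecol-sym S₀ a~b)) (S₀-ecol a≢u b≢u)

  S₀-edge-to-u : ∀ {p} → Adj G p u → ecol S₀ p u ≡ nothing
  S₀-edge-to-u p~u with neighbour-of-u (Adj-sym G p~u)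
  ... | inj₁ refl = trans (Drop-ux.off (farˡ (≢-sym u≢v) v≢x)) (Restrict.edgeColor-on (inj₂ (refl , refl)))
  ... | inj₂ refl = Drop-ux.on (inj₂ (refl , refl))

  missing₀ : ∀ {p c} → Adj G p u → Avoids S₀ p u c → Missing S₀ p c
  missing₀ p~u avoids = avoids⇒missing avoids (≡nothing⇒≢just (S₀-edge-to-u p~u))

  record Ready (S : PartialColoring) : Set where
    field
      -- u and the edge ux are uncolored
      bare-u : ∀ c → Avoids S u v c
      vertices-colored : ∀ a → a ≢ u → a ≢ w → vcol S a ≢ nothing
      edges-colored : ∀ {a b} → Adj G a b → a ≢ u → b ≢ u → ecol S a b ≢ nothing

  ready₀ : Ready S₀
  ready₀ = record
    { bare-u = λ c → avoiding (vertex-u c) (edge-u c)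
    ; vertices-colored = λ a a≢u a≢w →
        ≡just⇒≢nothing (trans (Drop-w.off a≢w) (Restrict.vertexColor-off a≢u))
    ; edges-colored = λ a~b a≢u b≢u → ≡just⇒≢nothing (S₀-ecol a≢u b≢u)
    }
    where
    vertex-u : ∀ c → vcol S₀ u ≢ just c
    vertex-u c h = proj₁ (Restrict.vertexColor-just (trans (sym (Drop-w.off u≢w)) h)) refl

    edge-u : ∀ c {t} → Adj G u t → t ≢ v → ecol S₀ u t ≢ just c
    edge-u c u~t t≢v with neighbour-of-u u~t
    ... | inj₁ t≡v = ⊥-elim (t≢v t≡v)
    ... | inj₂ refl = ≡nothing⇒≢just (Drop-ux.on (inj₁ (refl , refl)))

  ready-step : ∀ {S T} → Ready S → Agree S T u → (∀ a → vcol T a ≡ vcol S a) →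
               (∀ {a b} → ecol S a b ≢ nothing → ecol T a b ≢ nothing) → Ready T
  ready-step ready agree-u vcol≡ colored = record
    { bare-u = λ c → avoids-agree agree-u (bare-u c)
    ; vertices-colored = λ a a≢u a≢w h → vertices-colored a a≢u a≢w (trans (sym (vcol≡ a)) h)
    ; edges-colored = λ a~b a≢u b≢u → colored (edges-colored a~b a≢u b≢u)
    }
    where open Ready ready

  complete : ∀ {S c₁ c₂} → Ready S → c₁ ≢ c₂ → Avoids S v u c₁ → Avoids S x u c₂ →
             TotalColoring k G
  complete {S} {c₁} {c₂} ready c₁≢c₂ avoids-v avoids-x = toTotal S₄.coloring all-vertices all-edges
    where
    open Ready ready

    module S₁ = ColorEdge S u v c₁ (bare-u c₁) avoids-v

    uv≡c₁ : ecol S₁.coloring u v ≡ just c₁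
    uv≡c₁ = S₁.on (inj₁ (refl , refl))

    avoids-u : Avoids S₁.coloring u x c₂
    avoids-u = avoiding (Avoids.vertex (bare-u c₂)) λ u~t t≢x → case neighbour-of-u u~t of λ
      { (inj₁ refl) → ≡just⇒≢just uv≡c₁ c₁≢c₂
      ; (inj₂ t≡x) → ⊥-elim (t≢x t≡x) }

    module S₂ = ColorEdge S₁.coloring u x c₂ avoids-u
                  (avoids-agree (S₁.agree (≢-sym u≢x) (≢-sym v≢x)) avoids-x)

    cover-w : ∀ {t} → Adj G w t → t ∈ v ∷ y ∷ z ∷ []
    cover-w w~t with neighbour-of-w w~t
    ... | inj₁ refl = here refl
    ... | inj₂ (inj₁ refl) = there (here refl)
    ... | inj₂ (inj₂ refl) = there (there (here refl))

    cover-u : ∀ {t} → Adj G u t → t ∈ v ∷ x ∷ []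
    cover-u u~t with neighbour-of-u u~t
    ... | inj₁ refl = here refl
    ... | inj₂ refl = there (here refl)

    module S₃ = ColorVertex S₂.coloring w _
                  (proj₂ (∃-vertexAvoids S₂.coloring (v ∷ y ∷ z ∷ []) cover-w 7≤k))
    module S₄ = ColorVertex S₃.coloring u _
                  (proj₂ (∃-vertexAvoids S₃.coloring (v ∷ x ∷ []) cover-u 5≤k))

    all-vertices : ∀ a → vcol S₄.coloring a ≢ nothing
    all-vertices a = S₄.colored (λ ()) λ a≢u → S₃.colored (λ ()) λ a≢w → vertices-colored a a≢u a≢w

    edge-at-u : ∀ {b} → Adj G u b → ecol S₂.coloring u b ≢ nothing
    edge-at-u u~b with neighbour-of-u u~b
    ... | inj₁ refl = ≡just⇒≢nothing (trans (S₂.off (farʳ (≢-sym u≢v) v≢x)) uv≡c₁)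
    ... | inj₂ refl = ≡just⇒≢nothing (S₂.on (inj₁ (refl , refl)))

    all-edges : ∀ {a b} → Adj G a b → ecol S₄.coloring a b ≢ nothing
    all-edges {a} {b} a~b with a ≟ u | b ≟ u
    ... | yes refl | _ = edge-at-u a~b
    ... | no _ | yes refl = λ h → edge-at-u (Adj-sym G a~b) (trans (sym (ecol-sym S₂.coloring a~b)) h)
    ... | no a≢u | no b≢u = S₂.colored (λ ()) (S₁.colored (λ ()) (edges-colored a~b a≢u b≢u))

  -- The setting where α is missing at both v and x, so that uv and ux cannot be colored directly.
  module Tight (x≢w : x ≢ w) {α : Fin k} (α-free-v : Missing S₀ v α) (α-free-x : Missing S₀ x α) where

    private
      y≢u : y ≢ u
      y≢u refl with neighbour-of-u (Adj-sym G w~y)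
      ... | inj₁ w≡v = w≢v w≡v
      ... | inj₂ w≡x = x≢w (sym w≡x)

      z≢u : z ≢ u
      z≢u refl with neighbour-of-u (Adj-sym G w~z)
      ... | inj₁ w≡v = w≢v w≡v
      ... | inj₂ w≡x = x≢w (sym w≡x)

      v≢u : v ≢ u
      v≢u = ≢-sym u≢v

      w≢u : w ≢ u
      w≢u = ≢-sym u≢w

      x≢u : x ≢ u
      x≢u = ≢-sym u≢x

      x≢v : x ≢ v
      x≢v = ≢-sym v≢x

      v~w : Adj G v w
      v~w = Adj-sym G w~v

    γ κ μ ρ σ : Fin k
    γ = φe v w
    κ = φe v x
    μ = φe v y
    ρ = φe w y
    σ = φe w z

    private
      α-missing-at-v : ∀ {t} → Adj G v t → t ≢ u → φe v t ≢ α
      α-missing-at-v v~t t≢u refl = Missing.edge α-free-v v~t (S₀-ecol v≢u t≢u)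

      γ≢α : γ ≢ α
      γ≢α = α-missing-at-v v~w w≢u

      κ≢α : κ ≢ α
      κ≢α = α-missing-at-v v~x x≢u

      μ≢α : μ ≢ α
      μ≢α = α-missing-at-v v~y y≢u

      γ≢κ : γ ≢ κ
      γ≢κ = apart⇒≢ (ee-apart S₀ v~w v~x (≢-sym x≢w)) (S₀-ecol v≢u w≢u) (S₀-ecol v≢u x≢u)

      μ≢γ : μ ≢ γ
      μ≢γ = apart⇒≢ (ee-apart S₀ v~y v~w (≢-sym w≢y)) (S₀-ecol v≢u y≢u) (S₀-ecol v≢u w≢u)

      μ≢κ : y ≢ x → μ ≢ κ
      μ≢κ y≢x = apart⇒≢ (ee-apart S₀ v~y v~x y≢x) (S₀-ecol v≢u y≢u) (S₀-ecol v≢u x≢u)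

      avoids-wv : ∀ {c} → ρ ≢ c → σ ≢ c → Avoids S₀ w v c
      avoids-wv ρ≢c σ≢c = avoiding (≡nothing⇒≢just Drop-w.on) λ w~t t≢v →
        case neighbour-of-w w~t of λ
          { (inj₁ t≡v) → ⊥-elim (t≢v t≡v)
          ; (inj₂ (inj₁ refl)) → ≡just⇒≢just (S₀-ecol w≢u y≢u) ρ≢c
          ; (inj₂ (inj₂ refl)) → ≡just⇒≢just (S₀-ecol w≢u z≢u) σ≢c }

      avoids-wy : ∀ {c} → γ ≢ c → σ ≢ c → Avoids S₀ w y c
      avoids-wy γ≢c σ≢c = avoiding (≡nothing⇒≢just Drop-w.on) λ w~t t≢y →
        case neighbour-of-w w~t of λ
          { (inj₁ refl) → ≡just⇒≢just (S₀-ecol′ v~w v≢u w≢u) γ≢c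
          ; (inj₂ (inj₁ t≡y)) → ⊥-elim (t≢y t≡y)
          ; (inj₂ (inj₂ refl)) → ≡just⇒≢just (S₀-ecol w≢u z≢u) σ≢c }

    recolor-vw : ρ ≢ α → σ ≢ α → TotalColoring k G
    recolor-vw ρ≢α σ≢α = complete ready γ≢α (missing⇒avoids γ-free-v) (missing⇒avoids α-free-x′)
      where
      module T = ColorEdge S₀ v w α (missing⇒avoids α-free-v) (avoids-wv ρ≢α σ≢α)

      ready : Ready T.coloring
      ready = ready-step ready₀ (T.agree u≢v u≢w) (λ _ → refl) (T.colored (λ ()))

      γ-free-v : Missing T.coloring v γ
      γ-free-v = T.frees v~w (S₀-ecol v≢u w≢u) (γ≢α ∘ sym ∘ just-injective) (inj₁ (refl , refl))

      α-free-x′ : Missing T.coloring x α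
      α-free-x′ = missing-agree (T.agree x≢v x≢w) α-free-x

    private
      module T₁ = ColorEdge S₀ v x α (missing⇒avoids α-free-v) (missing⇒avoids α-free-x)

      ready₁ : Ready T₁.coloring
      ready₁ = ready-step ready₀ (T₁.agree u≢v u≢x) (λ _ → refl) (T₁.colored (λ ()))

      κ-free-v : Missing T₁.coloring v κ
      κ-free-v = T₁.frees v~x (S₀-ecol v≢u x≢u) (κ≢α ∘ sym ∘ just-injective) (inj₁ (refl , refl))

      κ-free-x : Missing T₁.coloring x κ
      κ-free-x = T₁.frees (Adj-sym G v~x) (S₀-ecol′ v~x v≢u x≢u) (κ≢α ∘ sym ∘ just-injective)
                   (inj₂ (refl , refl))

    recolor-vx-vw : ρ ≢ κ → σ ≢ κ → TotalColoring k G
    recolor-vx-vw ρ≢κ σ≢κ = complete ready γ≢κ (missing⇒avoids γ-free-v) (missing⇒avoids κ-free-x′)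
      where
      module T₂ = ColorEdge T₁.coloring v w κ (missing⇒avoids κ-free-v)
                    (avoids-agree (T₁.agree w≢v (≢-sym x≢w)) (avoids-wv ρ≢κ σ≢κ))

      ready : Ready T₂.coloring
      ready = ready-step ready₁ (T₂.agree u≢v u≢w) (λ _ → refl) (T₂.colored (λ ()))

      γ-free-v : Missing T₂.coloring v γ
      γ-free-v = T₂.frees v~w (trans (T₁.off (farʳ w≢v (≢-sym x≢w))) (S₀-ecol v≢u w≢u))
                   (γ≢κ ∘ sym ∘ just-injective) (inj₁ (refl , refl))

      κ-free-x′ : Missing T₂.coloring x κ
      κ-free-x′ = missing-agree (T₂.agree x≢v x≢w) κ-free-x

    swap-at-y : ρ ≡ α → σ ≡ κ → TotalColoring k G
    swap-at-y ρ≡α σ≡κ = complete ready μ≢α (missing⇒avoids T.frees) (missing⇒avoids α-free-x′)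
      where
      y≢x : y ≢ x
      y≢x refl = Missing.edge α-free-x (Adj-sym G w~y) (trans (S₀-ecol′ w~y w≢u y≢u) (cong just ρ≡α))

      module T = Swap S₀ (Adj-sym G v~y) (Adj-sym G w~y) (≢-sym w≢v)
                   (S₀-ecol′ v~y v≢u y≢u) (S₀-ecol′ w~y w≢u y≢u)
                   (missing⇒avoids (subst (Missing S₀ v) (sym ρ≡α) α-free-v))
                   (avoids-wy (≢-sym μ≢γ) (λ σ≡μ → μ≢κ y≢x (trans (sym σ≡μ) σ≡κ)))

      ready : Ready T.coloring
      ready = ready-step ready₀ (T.agree (≢-sym y≢u) u≢v u≢w) (λ _ → refl) T.colored

      α-free-x′ : Missing T.coloring x α
      α-free-x′ = missing-agree (T.agree (≢-sym y≢x) x≢v x≢w) α-free-x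

    recolor-vx-swap-at-y : ρ ≡ κ → σ ≡ α → TotalColoring k G
    recolor-vx-swap-at-y ρ≡κ σ≡α =
      complete ready (μ≢κ y≢x) (missing⇒avoids T₂.frees) (missing⇒avoids κ-free-x′)
      where
      y≢x : y ≢ x
      y≢x refl = apart⇒≢ (ee-apart S₀ (Adj-sym G w~y) (Adj-sym G v~x) w≢v)
                   (S₀-ecol′ w~y w≢u y≢u) (S₀-ecol′ v~x v≢u x≢u) ρ≡κ

      agree-y : Agree S₀ T₁.coloring y
      agree-y = T₁.agree (≢-sym v≢y) y≢x

      module T₂ = Swap T₁.coloring (Adj-sym G v~y) (Adj-sym G w~y) (≢-sym w≢v)
                    (trans (Agree.edge agree-y v) (S₀-ecol′ v~y v≢u y≢u))
                    (trans (Agree.edge agree-y w) (S₀-ecol′ w~y w≢u y≢u))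
                    (missing⇒avoids (subst (Missing T₁.coloring v) (sym ρ≡κ) κ-free-v))
                    (avoids-agree (T₁.agree w≢v (≢-sym x≢w))
                      (avoids-wy (≢-sym μ≢γ) (λ σ≡μ → μ≢α (trans (sym σ≡μ) σ≡α))))

      ready : Ready T₂.coloring
      ready = ready-step ready₁ (T₂.agree (≢-sym y≢u) u≢v u≢w) (λ _ → refl) T₂.colored

      κ-free-x′ : Missing T₂.coloring x κ
      κ-free-x′ = missing-agree (T₂.agree (≢-sym y≢x) x≢v x≢w) κ-free-x

    extension : TotalColoring k G
    extension with ρ ≟ α | σ ≟ α | ρ ≟ κ | σ ≟ κ
    ... | no ρ≢α | no σ≢α | _ | _ = recolor-vw ρ≢α σ≢α
    ... | _ | _ | no ρ≢κ | no σ≢κ = recolor-vx-vw ρ≢κ σ≢κ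
    ... | yes ρ≡α | _ | _ | yes σ≡κ = swap-at-y ρ≡α σ≡κ
    ... | _ | yes σ≡α | yes ρ≡κ | _ = recolor-vx-swap-at-y ρ≡κ σ≡α
    ... | yes ρ≡α | _ | yes ρ≡κ | _ = ⊥-elim (κ≢α (trans (sym ρ≡κ) ρ≡α))
    ... | _ | yes σ≡α | _ | yes σ≡κ = ⊥-elim (κ≢α (trans (sym σ≡κ) σ≡α))

  private
    x≢w : ¬ suc (deg G x) < k → x ≢ w
    x≢w no-room refl = no-room (subst (λ d → suc d < k) (sym deg-w) 5≤k)

  extension : TotalColoring k G
  extension
    with α , _ , avoids-v ← ∃-avoids S₀ [] (Adj-sym G u~v) deg-v
       | suc (deg G x) <? k
  ... | yes room
    with β , β∉α , avoids-x ← ∃-avoids S₀ (α ∷ []) (Adj-sym G u~x) room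
    = complete ready₀ (β∉α ∘ here ∘ sym) avoids-v avoids-x
  ... | no no-room
    with β , _ , avoids-x ← ∃-avoids S₀ [] (Adj-sym G u~x) deg-x
    with β ≟ α
  ...   | no β≢α = complete ready₀ (β≢α ∘ sym) avoids-v avoids-x
  ...   | yes refl = Tight.extension (x≢w no-room) (missing₀ (Adj-sym G u~v) avoids-v)
                                                   (missing₀ (Adj-sym G u~x) avoids-x)

lemma2p6 : ∀ {m} (G : Graph (suc m)) (R : RotationSystem G) → PlaneEmbedding G R →
    MinimalCounterexample G → (v : Fin (suc m)) → deg G v ≡ 8 →
    (u : Fin (suc m)) → Adj G v u → deg G u ≡ 2 → OnCommon3Face R u v →
    ¬ (Σ (Fin (suc m)) λ w → Adj G v w × deg G w ≡ 3 × OnCommon3Face R w v)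
lemma2p6 G R _ mc v deg-v u v~u deg-u uv-face (w , v~w , deg-w , wv-face)
  with x , u~x , v~x ← common-neighbour G R uv-face (Adj⇒≢ G (Adj-sym G v~u))
     | y , w~y , v~y ← common-neighbour G R wv-face (Adj⇒≢ G (Adj-sym G v~w))
  = MinimalCounterexample.notColorable mc
      (Reducible.extension (m≤m+n 7 2) (Adj-sym G v~u) u~x v~x deg-u (Adj-sym G v~w) w~y v~y deg-w
         (s≤s (≤-reflexive deg-v)) (s≤s (proj₁ (MinimalCounterexample.maxDeg8 mc) x))
         (MinimalCounterexample.delEdge mc u v (Adj-sym G v~u)))
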